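{- The rewrite systems $\to_a$ and $\to_\ell$ are AC-strongly-normalising: for each $R\in\{\to_a,\to_\ell\}$ and every term $M$ there is a number $n$ such that every $R$-rewrite sequence starting at $M$ contains fewer than $n$ steps that are not instances of the rules Asso or Com.
   Context: Fix a ring of scalars (elements $\alpha,\beta$). Terms: $M,N,L ::= V \mid (M)~N \mid \alpha.M \mid M+N$; values $V,W ::= 0 \mid B \mid \alpha.V \mid V+W$; base terms $B ::= x \mid \lambda x\,M$. Rewrite rules: $(A)$ $(M+N)~L\to (M)~L+(N)~L$; $(\alpha.M)~N\to\alpha.(M)~N$; $(0)~M\to 0$. $(A_l)$ $(M+N)~V\to(M)~V+(N)~V$; $(\alpha.M)~V\to\alpha.(M)~V$; $(0)~V\to 0$ ($V$ value). $(A_r)$ $(B)~(M+N)\to(B)~M+(B)~N$; $(B)~(\alpha.M)\to\alpha.(B)~M$; $(B)~0\to 0$ ($B$ base term). (Asso) $M+(N+L)\to(M+N)+L$ and $(M+N)+L\to M+(N+L)$. (Com) $M+N\to N+M$. $(F)$ $\alpha.M+\beta.M\to(\alpha+\beta).M$; $\alpha.M+M\to(\alpha+1).M$; $M+M\to(1+1).M$; $\alpha.(\beta.M)\to(\alpha\beta).M$. $(S)$ $\alpha.(M+N)\to\alpha.M+\alpha.N$; $1.M\to M$; $0.M\to 0$; $\alpha.0\to 0$; $0+M\to M$. Context rules $(\xi)$: from $M\to M'$ infer $(M)~N\to(M')~N$, $M+N\to M'+N$, $N+M\to N+M'$, $\alpha.M\to\alpha.M'$; $(\xi_{lin})$: from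 $M\to M'$ infer $(V)~M\to(V)~M'$ for $V$ a value. $\to_a$ is generated by $A\cup\mathrm{Asso}\cup\mathrm{Com}\cup F\cup S$ closed under $\xi$; $\to_\ell$ by $A_l\cup A_r\cup\mathrm{Asso}\cup\mathrm{Com}\cup F\cup S$ closed under $\xi,\xi_{lin}$. Each rewrite step applies one base rule inside a context; a step is an Asso/Com step if that rule is Asso or Com. -}

module Defs where

open import Level using (_⊔_)
open import Algebra.Bundles using (Ring)
open import Data.Nat using (ℕ; suc; _<_)
open import Data.Product using (∃-syntax)

data Kind : Set where
  ac nonac : Kind

module Lambda {c ℓ} (R : Ring c ℓ) where
  open Ring R using ()
    renaming (Carrier to S; _+_ to _+s_; _*_ to _*s_; 0# to 0s; 1# to 1s)

  infixl 6 _⊕_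
  infixr 7 _·_

  data Term : Set c where
    𝟘   : Term
    var : ℕ → Term
    lam : ℕ → Term → Term
    app : Term → Term → Term
    _·_ : S → Term → Term
    _⊕_ : Term → Term → Term

  data Base : Term → Set c where
    var : ∀ x → Base (var x)
    lam : ∀ x M → Base (lam x M)

  data Value : Term → Set c where
    𝟘   : Value 𝟘
    base : ∀ {B} → Base B → Value B
    _·_ : ∀ α {V} → Value V → Value (α · V)
    _⊕_ : ∀ {V W} → Value V → Value W → Value (V ⊕ W)

  data Common : Kind → Term → Term → Set c where
    asso₁ : ∀ M N L → Common ac (M ⊕ (N ⊕ L)) ((M ⊕ N) ⊕ L)
    asso₂ : ∀ M N L → Common ac ((M ⊕ N) ⊕ L) (M ⊕ (N ⊕ L))
    com   : ∀ M N → Common ac (M ⊕ N) (N ⊕ M)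
    F₁ : ∀ α β M → Common nonac (α · M ⊕ β · M) ((α +s β) · M)
    F₂ : ∀ α M → Common nonac (α · M ⊕ M) ((α +s 1s) · M)
    F₃ : ∀ M → Common nonac (M ⊕ M) ((1s +s 1s) · M)
    F₄ : ∀ α β M → Common nonac (α · (β · M)) ((α *s β) · M)
    S₁ : ∀ α M N → Common nonac (α · (M ⊕ N)) (α · M ⊕ α · N)
    S₂ : ∀ M → Common nonac (1s · M) M
    S₃ : ∀ M → Common nonac (0s · M) 𝟘
    S₄ : ∀ α → Common nonac (α · 𝟘) 𝟘
    S₅ : ∀ M → Common nonac (𝟘 ⊕ M) M

  data RuleA : Kind → Term → Term → Set c where
    common : ∀ {k M N} → Common k M N → RuleA k M N
    A₁ : ∀ M N L → RuleA nonac (app (M ⊕ N) L) (app M L ⊕ app N L)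
    A₂ : ∀ α M N → RuleA nonac (app (α · M) N) (α · app M N)
    A₃ : ∀ M → RuleA nonac (app 𝟘 M) 𝟘

  data RuleL : Kind → Term → Term → Set c where
    common : ∀ {k M N} → Common k M N → RuleL k M N
    Al₁ : ∀ M N {V} → Value V → RuleL nonac (app (M ⊕ N) V) (app M V ⊕ app N V)
    Al₂ : ∀ α M {V} → Value V → RuleL nonac (app (α · M) V) (α · app M V)
    Al₃ : ∀ {V} → Value V → RuleL nonac (app 𝟘 V) 𝟘
    Ar₁ : ∀ {B} → Base B → ∀ M N → RuleL nonac (app B (M ⊕ N)) (app B M ⊕ app B N)
    Ar₂ : ∀ {B} → Base B → ∀ α M → RuleL nonac (app B (α · M)) (α · app B M)
    Ar₃ : ∀ {B} → Base B → RuleL nonac (app B 𝟘) 𝟘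

  data Ξ (Rule : Kind → Term → Term → Set c) : Kind → Term → Term → Set c where
    rule  : ∀ {k M M'} → Rule k M M' → Ξ Rule k M M'
    appL  : ∀ {k M M'} N → Ξ Rule k M M' → Ξ Rule k (app M N) (app M' N)
    plusL : ∀ {k M M'} N → Ξ Rule k M M' → Ξ Rule k (M ⊕ N) (M' ⊕ N)
    plusR : ∀ {k M M'} N → Ξ Rule k M M' → Ξ Rule k (N ⊕ M) (N ⊕ M')
    scal  : ∀ {k M M'} α → Ξ Rule k M M' → Ξ Rule k (α · M) (α · M')

  data Ξlin (Rule : Kind → Term → Term → Set c) : Kind → Term → Term → Set c where
    rule  : ∀ {k M M'} → Rule k M M' → Ξlin Rule k M M'
    appL  : ∀ {k M M'} N → Ξlin Rule k M M' → Ξlin Rule k (app M N) (app M' N)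
    plusL : ∀ {k M M'} N → Ξlin Rule k M M' → Ξlin Rule k (M ⊕ N) (M' ⊕ N)
    plusR : ∀ {k M M'} N → Ξlin Rule k M M' → Ξlin Rule k (N ⊕ M) (N ⊕ M')
    scal  : ∀ {k M M'} α → Ξlin Rule k M M' → Ξlin Rule k (α · M) (α · M')
    appR  : ∀ {k M M' V} → Value V → Ξlin Rule k M M' → Ξlin Rule k (app V M) (app V M')

  _⟶a⟨_⟩_ : Term → Kind → Term → Set c
  M ⟶a⟨ k ⟩ N = Ξ RuleA k M N

  _⟶ℓ⟨_⟩_ : Term → Kind → Term → Set c
  M ⟶ℓ⟨ k ⟩ N = Ξlin RuleL k M N

  data Seq (Step : Term → Kind → Term → Set c) : Term → ℕ → Term → Set c where
    done    : ∀ {M} → Seq Step M 0 M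
    stepAC  : ∀ {M N L n} → Step M ac N → Seq Step N n L → Seq Step M n L
    stepNon : ∀ {M N L n} → Step M nonac N → Seq Step N n L → Seq Step M (suc n) L

  AC-SN : (Term → Kind → Term → Set c) → Set c
  AC-SN Step = ∀ M → ∃[ n ] (∀ {k N} → Seq Step M k N → k < n)

module Submission where

open import Defs
open import Level using (Level)
open import Algebra.Bundles using (Ring)
open import Data.Product using (_×_; _,_)
open import Data.Nat using (ℕ; suc; _+_; _*_; _<_; _≤_; z<s; s≤s)
open import Data.Nat.Properties
open import Data.Nat.Tactic.RingSolver using (solve-∀)
open import Relation.Binary.Definitions using (Monotonic₁)
open import Relation.Binary.PropositionalEquality

-- Give 0, +, scalar multiplication and application the polynomial
-- interpretations 0, 2 + a + b, 1 + 2a and (2 + 3a)(2 + 3b).  The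
-- interpretation of + is associative and commutative, so Asso and Com steps
-- preserve the size of a term, while every other rule strictly decreases it;
-- since all interpretations are strictly monotone, this persists under every
-- context.  Along any rewrite sequence from M the size therefore drops at each
-- non-Asso/Com step, bounding their number by the size of M.

_⊒⟨_⟩_ : ℕ → Kind → ℕ → Set
m ⊒⟨ ac ⟩ n = n ≡ m
m ⊒⟨ nonac ⟩ n = n < m

⊒-map : ∀ {f} → Monotonic₁ _<_ _<_ f → ∀ k {m n} → m ⊒⟨ k ⟩ n → f m ⊒⟨ k ⟩ f n
⊒-map {f} mono ac n≡m = cong f n≡m
⊒-map mono nonac n<m = mono n<m

<-by-gap : ∀ {m n} d → n ≡ m + suc d → m < n
<-by-gap {m} d refl = m<m+n m z<s

plus : ℕ → ℕ → ℕ
plus a b = 2 + (a + b)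

scale : ℕ → ℕ
scale a = suc (2 * a)

apply : ℕ → ℕ → ℕ
apply a b = (2 + 3 * a) * (2 + 3 * b)

plus-comm : ∀ a b → plus a b ≡ plus b a
plus-comm a b = cong (2 +_) (+-comm a b)

-- The ring solver does not unfold plus, scale and apply, so each identity it
-- proves below is stated with these interpretations written out.
plus-assoc : ∀ a b c → plus (plus a b) c ≡ plus a (plus b c)
plus-assoc = identity
  where
  identity : ∀ a b c → 2 + ((2 + (a + b)) + c) ≡ 2 + (a + (2 + (b + c)))
  identity = solve-∀

apply-comm : ∀ a b → apply a b ≡ apply b a
apply-comm a b = *-comm (2 + 3 * a) (2 + 3 * b)

<plusˡ : ∀ a b → a < plus a b
<plusˡ a b = s≤s (m≤n⇒m≤1+n (m≤m+n a b))

<plusʳ : ∀ a b → b < plus a b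
<plusʳ a b = subst (b <_) (plus-comm b a) (<plusˡ b a)

<scale : ∀ a → a < scale a
<scale a = s≤s (m≤m+n a (a + 0))

scale<plus-self : ∀ a → scale a < plus a a
scale<plus-self a = <-by-gap 0 (identity a)
  where
  identity : ∀ a → 2 + (a + a) ≡ suc (2 * a) + 1
  identity = solve-∀

plus-scale<scale-plus : ∀ a b → plus (scale a) (scale b) < scale (plus a b)
plus-scale<scale-plus a b = <-by-gap 0 (identity a b)
  where
  identity : ∀ a b → suc (2 * (2 + (a + b))) ≡ 2 + (suc (2 * a) + suc (2 * b)) + 1
  identity = solve-∀

plus-apply<apply-plusˡ : ∀ a b c → plus (apply a c) (apply b c) < apply (plus a b) c
plus-apply<apply-plusˡ a b c = <-by-gap (5 + 12 * c) (identity a b c)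
  where
  identity : ∀ a b c → (2 + 3 * (2 + (a + b))) * (2 + 3 * c)
                     ≡ 2 + ((2 + 3 * a) * (2 + 3 * c) + (2 + 3 * b) * (2 + 3 * c)) + suc (5 + 12 * c)
  identity = solve-∀

plus-apply<apply-plusʳ : ∀ a b c → plus (apply a b) (apply a c) < apply a (plus b c)
plus-apply<apply-plusʳ a b c =
  subst₂ _<_ (cong₂ plus (apply-comm b a) (apply-comm c a)) (apply-comm (plus b c) a)
    (plus-apply<apply-plusˡ b c a)

scale-apply<apply-scaleˡ : ∀ a b → scale (apply a b) < apply (scale a) b
scale-apply<apply-scaleˡ a b = <-by-gap (3 * b) (identity a b)
  where
  identity : ∀ a b → (2 + 3 * suc (2 * a)) * (2 + 3 * b)
                   ≡ suc (2 * ((2 + 3 * a) * (2 + 3 * b))) + suc (3 * b)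
  identity = solve-∀

scale-apply<apply-scaleʳ : ∀ a b → scale (apply a b) < apply a (scale b)
scale-apply<apply-scaleʳ a b =
  subst₂ _<_ (cong scale (apply-comm b a)) (apply-comm (scale b) a) (scale-apply<apply-scaleˡ b a)

plus-monoˡ-< : ∀ b → Monotonic₁ _<_ _<_ (λ a → plus a b)
plus-monoˡ-< b a<a' = +-monoʳ-< 2 (+-monoˡ-< b a<a')

plus-monoʳ-< : ∀ a → Monotonic₁ _<_ _<_ (plus a)
plus-monoʳ-< a b<b' = +-monoʳ-< 2 (+-monoʳ-< a b<b')

scale-mono-< : Monotonic₁ _<_ _<_ scale
scale-mono-< a<a' = s≤s (*-monoʳ-< 2 a<a')

apply-monoˡ-< : ∀ b → Monotonic₁ _<_ _<_ (λ a → apply a b)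
apply-monoˡ-< b a<a' = *-monoˡ-< (2 + 3 * b) (+-monoʳ-< 2 (*-monoʳ-< 3 a<a'))

apply-monoʳ-< : ∀ a → Monotonic₁ _<_ _<_ (apply a)
apply-monoʳ-< a b<b' = *-monoʳ-< (2 + 3 * a) (+-monoʳ-< 2 (*-monoʳ-< 3 b<b'))

module _ {c ℓ : Level} (R : Ring c ℓ) where
  open Lambda R

  size : Term → ℕ
  size 𝟘 = 0
  size (var x) = 1
  size (lam x M) = suc (size M)
  size (app M N) = apply (size M) (size N)
  size (α · M) = scale (size M)
  size (M ⊕ N) = plus (size M) (size N)

  SizeCompatible : (Kind → Term → Term → Set c) → Set c
  SizeCompatible Rel = ∀ {k M N} → Rel k M N → size M ⊒⟨ k ⟩ size N

  Common-size : SizeCompatible Common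
  Common-size (asso₁ M N L) = plus-assoc (size M) (size N) (size L)
  Common-size (asso₂ M N L) = sym (plus-assoc (size M) (size N) (size L))
  Common-size (com M N) = plus-comm (size N) (size M)
  Common-size (F₁ α β M) = <plusˡ (scale (size M)) (scale (size M))
  Common-size (F₂ α M) = <plusˡ (scale (size M)) (size M)
  Common-size (F₃ M) = scale<plus-self (size M)
  Common-size (F₄ α β M) = <scale (scale (size M))
  Common-size (S₁ α M N) = plus-scale<scale-plus (size M) (size N)
  Common-size (S₂ M) = <scale (size M)
  Common-size (S₃ M) = z<s
  Common-size (S₄ α) = z<s
  Common-size (S₅ M) = <plusʳ 0 (size M)

  RuleA-size : SizeCompatible RuleA
  RuleA-size (common r) = Common-size r
  RuleA-size (A₁ M N L) = plus-apply<apply-plusˡ (size M) (size N) (size L)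
  RuleA-size (A₂ α M N) = scale-apply<apply-scaleˡ (size M) (size N)
  RuleA-size (A₃ M) = z<s

  RuleL-size : SizeCompatible RuleL
  RuleL-size (common r) = Common-size r
  RuleL-size (Al₁ M N {V} _) = RuleA-size (A₁ M N V)
  RuleL-size (Al₂ α M {V} _) = RuleA-size (A₂ α M V)
  RuleL-size (Al₃ _) = z<s
  RuleL-size (Ar₁ {B} _ M N) = plus-apply<apply-plusʳ (size B) (size M) (size N)
  RuleL-size (Ar₂ {B} _ α M) = scale-apply<apply-scaleʳ (size B) (size M)
  RuleL-size (Ar₃ _) = z<s

  Ξ-size : ∀ {Rule} → SizeCompatible Rule → SizeCompatible (Ξ Rule)
  Ξ-size r (rule ρ) = r ρ
  Ξ-size r {k} (appL N s) = ⊒-map (apply-monoˡ-< (size N)) k (Ξ-size r s)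
  Ξ-size r {k} (plusL N s) = ⊒-map (plus-monoˡ-< (size N)) k (Ξ-size r s)
  Ξ-size r {k} (plusR N s) = ⊒-map (plus-monoʳ-< (size N)) k (Ξ-size r s)
  Ξ-size r {k} (scal α s) = ⊒-map scale-mono-< k (Ξ-size r s)

  Ξlin-size : ∀ {Rule} → SizeCompatible Rule → SizeCompatible (Ξlin Rule)
  Ξlin-size r (rule ρ) = r ρ
  Ξlin-size r {k} (appL N s) = ⊒-map (apply-monoˡ-< (size N)) k (Ξlin-size r s)
  Ξlin-size r {k} (plusL N s) = ⊒-map (plus-monoˡ-< (size N)) k (Ξlin-size r s)
  Ξlin-size r {k} (plusR N s) = ⊒-map (plus-monoʳ-< (size N)) k (Ξlin-size r s)
  Ξlin-size r {k} (scal α s) = ⊒-map scale-mono-< k (Ξlin-size r s)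
  Ξlin-size r {k} (appR {V = V} _ s) = ⊒-map (apply-monoʳ-< (size V)) k (Ξlin-size r s)

  module _ {Step : Term → Kind → Term → Set c}
           (step-size : SizeCompatible (λ k M N → Step M k N)) where

    Seq-size : ∀ {M n N} → Seq Step M n N → n + size N ≤ size M
    Seq-size done = ≤-refl
    Seq-size (stepAC s q) = subst (_ ≤_) (step-size s) (Seq-size q)
    Seq-size (stepNon s q) = ≤-trans (s≤s (Seq-size q)) (step-size s)

    AC-SN-by-size : AC-SN Step
    AC-SN-by-size M = suc (size M) , λ {n} {N} q → s≤s (≤-trans (m≤m+n n (size N)) (Seq-size q))

theorem1 : ∀ {c ℓ : Level} (R : Ring c ℓ) →
    Lambda.AC-SN R (Lambda._⟶a⟨_⟩_ R) × Lambda.AC-SN R (Lambda._⟶ℓ⟨_⟩_ R)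
theorem1 R = AC-SN-by-size R (Ξ-size R (RuleA-size R))
            , AC-SN-by-size R (Ξlin-size R (RuleL-size R))
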